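{- Let $G$ be a connected graph and let $r_1$ denote the number of dual mutual-visibility sets of $G$ of cardinality $1$ (the entry $r_1$ of the dual visibility spectrum of $G$). Then $r_1=0$ if and only if $\mu_{\rm t}(G)=0$.
   Context: For a graph $G$ and $X\subseteq V(G)$, two vertices $x,y$ are $X$-visible if there is a shortest $x,y$-path in $G$ with no internal vertex in $X$. $X$ is a total mutual-visibility set if any two vertices of $V(G)$ are $X$-visible; a dual mutual-visibility set if any two vertices of $X$ and any two vertices of $V(G)\setminus X$ are $X$-visible. $\mu_{\rm t}(G)$ is the maximum cardinality of a total mutual-visibility set. -}

module Defs where

open import Data.Nat using (ℕ; zero; suc; _≤_)
open import Data.Fin using (Fin)
open import Data.Fin.Subset using (Subset; _∈_; _∉_; ∣_∣)
open import Data.Bool using (Bool; true; false)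
open import Data.Product using (Σ; ∃; ∃-syntax; _×_; _,_)
open import Data.Unit using (⊤)
open import Relation.Binary.PropositionalEquality using (_≡_)
open import Relation.Nullary using (¬_)

record Graph : Set where
  field
    n     : ℕ
    adj   : Fin n → Fin n → Bool
    sym   : ∀ u v → adj u v ≡ adj v u
    irrefl : ∀ v → adj v v ≡ false

open Graph public

data Walk (G : Graph) : Fin (n G) → Fin (n G) → Set where
  []   : ∀ {x} → Walk G x x
  step : ∀ {x z} (y : Fin (n G)) → adj G x y ≡ true → Walk G y z → Walk G x z

len : ∀ {G x y} → Walk G x y → ℕ
len []           = zero
len (step _ _ w) = suc (len w)

-- No internal vertex (all vertices except the two end-vertices) lies in X.
InternallyAvoids : ∀ {G x y} → Subset (n G) → Walk G x y → Set
InternallyAvoids X [] = ⊤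
InternallyAvoids X (step y _ []) = ⊤
InternallyAvoids X (step y _ w@(step _ _ _)) = (y ∉ X) × InternallyAvoids X w

IsShortest : ∀ {G x y} → Walk G x y → Set
IsShortest {G} {x} {y} w = ∀ (w' : Walk G x y) → len w ≤ len w'

Connected : Graph → Set
Connected G = ∀ (x y : Fin (n G)) → Walk G x y

Visible : (G : Graph) → Subset (n G) → Fin (n G) → Fin (n G) → Set
Visible G X x y = ∃[ w ] (IsShortest {G} {x} {y} w × InternallyAvoids X w)

TotalMutualVisibility : (G : Graph) → Subset (n G) → Set
TotalMutualVisibility G X = ∀ x y → Visible G X x y

DualMutualVisibility : (G : Graph) → Subset (n G) → Set
DualMutualVisibility G X =
  (∀ x y → x ∈ X → y ∈ X → Visible G X x y) ×
  (∀ x y → x ∉ X → y ∉ X → Visible G X x y)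

r₁≡0 : Graph → Set
r₁≡0 G = ¬ (Σ (Subset (n G)) λ X → (∣ X ∣ ≡ 1) × DualMutualVisibility G X)

-- μ_t(G) = 0 : every total mutual-visibility set has cardinality 0
-- (the empty set is always one, so this says the maximum is 0).
μₜ≡0 : Graph → Set
μₜ≡0 G = ∀ (X : Subset (n G)) → TotalMutualVisibility G X → ∣ X ∣ ≡ 0

-- A set X of size one is a single vertex v, and a shortest walk never
-- revisits its end-vertices, so a shortest v,y-path has no internal vertex
-- in X.  Hence for |X| = 1 the two dual conditions already give total
-- mutual-visibility.  Conversely, mutual-visibility only gets easier for
-- smaller sets, so any vertex of a nonempty total mutual-visibility set
-- forms a total, hence dual, mutual-visibility set of size one.
module Submission where

open import Defs
open import Data.Bool using (true) renaming (_≟_ to _≟ᵇ_)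
open import Data.Fin using (Fin; _≟_)
open import Data.Fin.Properties using (any?)
open import Data.Fin.Subset using (Subset; _∈_; ∣_∣; ⁅_⁆; _-_; _⊆_)
open import Data.Fin.Subset.Properties
  using (∣⁅x⁆∣≡1; x∈⁅y⁆⇒x≡y; x∈p⇒∣p-x∣<∣p∣; x∈p∧x≢y⇒x∈p-y; p⊆q⇒∣p∣≤∣q∣;
         nonempty?; Empty-unique; ∣⊥∣≡0; _∈?_)
open import Data.Nat using (ℕ; zero; suc; _≤_; _<_; _+_; z<s; anyUpTo?)
open import Data.Nat.Induction using (Acc; acc; <-wellFounded)
open import Data.Nat.Properties using (<⇒≱; ≮⇒≥; 1+n≢0; m<m+n; m<n+m; suc-injective)
open import Data.Product using (Σ; _×_; _,_; proj₁; proj₂)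
open import Data.Sum using (_⊎_; inj₁; inj₂)
open import Data.Unit using (tt)
open import Function using (_∘_)
open import Function.Bundles using (_⇔_; mk⇔)
open import Relation.Binary.PropositionalEquality as ≡ using (_≡_; refl; trans; cong; subst; ≢-sym)
open import Relation.Nullary using (¬_; Dec; yes; no; contradiction)

∣p∣≡1∧x∈p∧y∈p⇒x≡y : ∀ {m} {p : Subset m} {x y} → ∣ p ∣ ≡ 1 → x ∈ p → y ∈ p → x ≡ y
∣p∣≡1∧x∈p∧y∈p⇒x≡y {p = p} {x} {y} ∣p∣≡1 x∈p y∈p with x ≟ y
... | yes x≡y = x≡y
... | no x≢y = contradiction 1≤∣p-x∣ (<⇒≱ ∣p-x∣<1)
  where
  ∣p-x∣<1 : ∣ p - x ∣ < 1
  ∣p-x∣<1 = subst (∣ p - x ∣ <_) ∣p∣≡1 (x∈p⇒∣p-x∣<∣p∣ x∈p)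

  ⁅y⁆⊆p-x : ⁅ y ⁆ ⊆ p - x
  ⁅y⁆⊆p-x z∈⁅y⁆ rewrite x∈⁅y⁆⇒x≡y y z∈⁅y⁆ = x∈p∧x≢y⇒x∈p-y y∈p (≢-sym x≢y)

  1≤∣p-x∣ : 1 ≤ ∣ p - x ∣
  1≤∣p-x∣ = subst (_≤ ∣ p - x ∣) (∣⁅x⁆∣≡1 y) (p⊆q⇒∣p∣≤∣q∣ ⁅y⁆⊆p-x)

module _ {G : Graph} where

  WalkOfLength : ℕ → Fin (n G) → Fin (n G) → Set
  WalkOfLength k x y = Σ (Walk G x y) λ w → len w ≡ k

  walkOfLength? : ∀ k x y → Dec (WalkOfLength k x y)
  walkOfLength? zero x y with x ≟ y
  ... | yes refl = yes ([] , refl)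
  ... | no x≢y = no λ { ([] , _) → x≢y refl ; (step _ _ _ , ()) }
  walkOfLength? (suc k) x y with any? firstStep?
    where
    firstStep? : ∀ z → Dec ((adj G x z ≡ true) × WalkOfLength k z y)
    firstStep? z with adj G x z ≟ᵇ true | walkOfLength? k z y
    ... | yes xz | yes zy = yes (xz , zy)
    ... | no ¬xz | _      = no (¬xz ∘ proj₁)
    ... | _      | no ¬zy = no (¬zy ∘ proj₂)
  ... | yes (z , xz , w , refl) = yes (step z xz w , refl)
  ... | no ∄z = no λ { ([] , ()) ; (step z xz w , eq) → ∄z (z , xz , w , suc-injective eq) }

  shortestWalk : ∀ {x y} → Walk G x y → Σ (Walk G x y) IsShortest
  shortestWalk w = go w (<-wellFounded (len w))
    where
    go : ∀ {x y} (w : Walk G x y) → Acc _<_ (len w) → Σ (Walk G x y) IsShortest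
    go {x} {y} w (acc rs) with anyUpTo? (λ k → walkOfLength? k x y) (len w)
    ... | yes (_ , k<∣w∣ , w′ , refl) = go w′ (rs k<∣w∣)
    ... | no ∄shorter = w , λ w′ → ≮⇒≥ λ w′<w → ∄shorter (len w′ , w′<w , w′ , refl)

  internallyAvoids-unless-split :
    ∀ (X : Subset (n G)) {a b} (w : Walk G a b) →
    (∀ {c} → c ∈ X → (p : Walk G a c) (q : Walk G c b) →
       0 < len p → 0 < len q → ¬ (len p + len q ≡ len w)) →
    InternallyAvoids X w
  internallyAvoids-unless-split X [] _ = tt
  internallyAvoids-unless-split X (step y xy []) _ = tt
  internallyAvoids-unless-split X (step y xy w@(step _ _ _)) no-split =
    (λ y∈X → no-split y∈X (step y xy []) w z<s z<s refl) ,
    internallyAvoids-unless-split X w λ c∈X p q 0<p 0<q ∣p∣+∣q∣≡∣w∣ →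
      no-split c∈X (step y xy p) q z<s 0<q (cong suc ∣p∣+∣q∣≡∣w∣)

  -- A split at an end-vertex leaves a shorter walk between the same ends.
  shortest⇒internallyAvoids-ends :
    ∀ (X : Subset (n G)) {a b} (w : Walk G a b) → IsShortest w →
    (∀ {c} → c ∈ X → c ≡ a ⊎ c ≡ b) → InternallyAvoids X w
  shortest⇒internallyAvoids-ends X w w-shortest X⊆ends =
    internallyAvoids-unless-split X w no-split
    where
    no-split : ∀ {c} → c ∈ X → (p : Walk G _ c) (q : Walk G c _) →
               0 < len p → 0 < len q → ¬ (len p + len q ≡ len w)
    no-split c∈X p q 0<p 0<q ∣p∣+∣q∣≡∣w∣ with X⊆ends c∈X
    ... | inj₁ refl = <⇒≱ (subst (len q <_) ∣p∣+∣q∣≡∣w∣ (m<n+m (len q) 0<p)) (w-shortest q)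
    ... | inj₂ refl = <⇒≱ (subst (len p <_) ∣p∣+∣q∣≡∣w∣ (m<m+n (len p) 0<q)) (w-shortest p)

  visible-if-⊆-ends : ∀ {X : Subset (n G)} {x y} → Walk G x y →
                      (∀ {c} → c ∈ X → c ≡ x ⊎ c ≡ y) → Visible G X x y
  visible-if-⊆-ends {X} w X⊆ends =
    let w′ , w′-shortest = shortestWalk w
    in w′ , w′-shortest , shortest⇒internallyAvoids-ends X w′ w′-shortest X⊆ends

  internallyAvoids-anti : ∀ {X Y : Subset (n G)} → Y ⊆ X →
                          ∀ {a b} (w : Walk G a b) → InternallyAvoids X w → InternallyAvoids Y w
  internallyAvoids-anti Y⊆X [] _ = tt
  internallyAvoids-anti Y⊆X (step _ _ []) _ = tt
  internallyAvoids-anti Y⊆X (step y _ w@(step _ _ _)) (y∉X , w-avoids) =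
    (y∉X ∘ Y⊆X) , internallyAvoids-anti Y⊆X w w-avoids

  totalMutualVisibility-anti : ∀ {X Y : Subset (n G)} → Y ⊆ X →
                               TotalMutualVisibility G X → TotalMutualVisibility G Y
  totalMutualVisibility-anti Y⊆X total x y =
    let w , w-shortest , w-avoids = total x y
    in w , w-shortest , internallyAvoids-anti Y⊆X w w-avoids

  total⇒dual : ∀ {X : Subset (n G)} → TotalMutualVisibility G X → DualMutualVisibility G X
  total⇒dual total = (λ x y _ _ → total x y) , (λ x y _ _ → total x y)

  dual⇒total-if-∣X∣≡1 : ∀ {X : Subset (n G)} → Connected G → ∣ X ∣ ≡ 1 →
                         DualMutualVisibility G X → TotalMutualVisibility G X
  dual⇒total-if-∣X∣≡1 {X} connected ∣X∣≡1 (inside , outside) x y with x ∈? X | y ∈? X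
  ... | yes x∈X | yes y∈X = inside x y x∈X y∈X
  ... | no x∉X  | no y∉X  = outside x y x∉X y∉X
  ... | yes x∈X | no _    =
    visible-if-⊆-ends (connected x y) λ c∈X → inj₁ (∣p∣≡1∧x∈p∧y∈p⇒x≡y ∣X∣≡1 c∈X x∈X)
  ... | no _    | yes y∈X =
    visible-if-⊆-ends (connected x y) λ c∈X → inj₂ (∣p∣≡1∧x∈p∧y∈p⇒x≡y ∣X∣≡1 c∈X y∈X)

proposition4p4 : (G : Graph) → Connected G → (r₁≡0 G ⇔ μₜ≡0 G)
proposition4p4 G connected = mk⇔ r₁≡0⇒μₜ≡0 μₜ≡0⇒r₁≡0
  where
  r₁≡0⇒μₜ≡0 : r₁≡0 G → μₜ≡0 G
  r₁≡0⇒μₜ≡0 r₁≡0 X total with nonempty? X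
  ... | no X-empty = trans (cong ∣_∣ (Empty-unique X-empty)) (∣⊥∣≡0 (n G))
  ... | yes (v , v∈X) =
    contradiction (⁅ v ⁆ , ∣⁅x⁆∣≡1 v , total⇒dual (totalMutualVisibility-anti ⁅v⁆⊆X total)) r₁≡0
    where
    ⁅v⁆⊆X : ⁅ v ⁆ ⊆ X
    ⁅v⁆⊆X c∈⁅v⁆ rewrite x∈⁅y⁆⇒x≡y v c∈⁅v⁆ = v∈X

  μₜ≡0⇒r₁≡0 : μₜ≡0 G → r₁≡0 G
  μₜ≡0⇒r₁≡0 μₜ≡0 (X , ∣X∣≡1 , dual) =
    1+n≢0 (trans (≡.sym ∣X∣≡1) (μₜ≡0 X (dual⇒total-if-∣X∣≡1 connected ∣X∣≡1 dual)))
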